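{- Let $G$ be a finite graph with at least one vertex and maximum degree $\Delta$, and let $\tau$ be a threshold assignment for $G$. Let $\bar{t}=\sum_{v\in V(G)}\tau(v)/|G|$ be the average threshold and $t_M=\max_{v\in V(G)}\tau(v)$ the maximum threshold, and assume $\bar t>0$. Then every $\tau$-dynamic monopoly $M$ of $G$ satisfies $$|M|\geq |G|\Big(1-\frac{\epsilon(G)}{\bar{t}}\Big)\Big(\frac{\bar{t}}{t_M}\Big) \geq |G|\Big(1-\frac{\epsilon(G)}{\bar{t}}\Big)\Big(\frac{\bar{t}}{\Delta}\Big),$$ where $\epsilon(G)=|E(G)|/|G|$.
   Context: Graphs are finite, undirected, without loops or multiple edges. A threshold assignment for $G$ is a function $\tau:V(G)\to\mathbb{N}\cup\{0\}$ with $\tau(v)\le \deg(v)$ for every vertex $v$. For $M\subseteq V(G)$, the $\tau$-dynamic process starting from $M$ is the sequence $D_0=M$ and, for $i\ge 0$, $D_{i+1}$ = set of vertices $v\notin D_0\cup\dots\cup D_i$ having at least $\tau(v)$ neighbours in $D_0\cup\dots\cup D_i$. The set $M$ is a $\tau$-dynamic monopoly (dynamo) if $\bigcup_i D_i=V(G)$. The edge density is $\epsilon(G)=|E(G)|/|G|$. -}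

module Defs where

open import Data.Nat as ℕ using (ℕ; zero; suc; _+_; _⊔_; _≤_; _≤ᵇ_; _<ᵇ_)
open import Data.Fin using (Fin; toℕ) renaming (zero to fz; suc to fs)
open import Data.Bool using (Bool; true; false; _∧_; _∨_; not; if_then_else_)
open import Data.Product using (∃)
open import Data.Integer using (+_)
open import Data.Rational as ℚ using (ℚ; 0ℚ; _÷_; _/_; ≢-nonZero)
open import Data.Rational.Properties using (_≟_)
open import Relation.Nullary using (yes; no)
open import Relation.Binary.PropositionalEquality using (_≡_)

record Graph (n : ℕ) : Set where
  field
    adj    : Fin n → Fin n → Bool
    sym    : ∀ u v → adj u v ≡ adj v u
    irrefl : ∀ v → adj v v ≡ false
open Graph public

sumF : ∀ {n} → (Fin n → ℕ) → ℕ
sumF {zero}  f = 0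
sumF {suc n} f = f fz + sumF (λ i → f (fs i))

card : ∀ {n} → (Fin n → Bool) → ℕ
card S = sumF (λ i → if S i then 1 else 0)

maxF : ∀ {n} → (Fin n → ℕ) → ℕ
maxF {zero}  f = 0
maxF {suc n} f = f fz ⊔ maxF (λ i → f (fs i))

deg : ∀ {n} → Graph n → Fin n → ℕ
deg G v = card (adj G v)

maxDeg : ∀ {n} → Graph n → ℕ
maxDeg G = maxF (deg G)

numEdges : ∀ {n} → Graph n → ℕ
numEdges G = sumF (λ u → card (λ v → adj G u v ∧ (toℕ u <ᵇ toℕ v)))

IsThreshold : ∀ {n} → Graph n → (Fin n → ℕ) → Set
IsThreshold G τ = ∀ v → τ v ≤ deg G v

nbrsIn : ∀ {n} → Graph n → (Fin n → Bool) → Fin n → ℕ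
nbrsIn G S v = card (λ u → adj G v u ∧ S u)

mutual
  D : ∀ {n} → Graph n → (Fin n → ℕ) → (Fin n → Bool) → ℕ → Fin n → Bool
  D G τ M zero    v = M v
  D G τ M (suc i) v = not (Acc G τ M i v) ∧ (τ v ≤ᵇ nbrsIn G (Acc G τ M i) v)

  Acc : ∀ {n} → Graph n → (Fin n → ℕ) → (Fin n → Bool) → ℕ → Fin n → Bool
  Acc G τ M zero    v = D G τ M zero v
  Acc G τ M (suc i) v = Acc G τ M i v ∨ D G τ M (suc i) v

IsDynamo : ∀ {n} → Graph n → (Fin n → ℕ) → (Fin n → Bool) → Set
IsDynamo G τ M = ∀ v → ∃ λ i → D G τ M i v ≡ true

-- rational division; convention p ÷ 0 = 0 (never used under the theorem's hypotheses)
_÷₀_ : ℚ → ℚ → ℚ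
p ÷₀ q with q ≟ 0ℚ
... | yes _  = 0ℚ
... | no q≢0 = _÷_ p q {{≢-nonZero q≢0}}

infixl 7 _÷₀_

ℕtoℚ : ℕ → ℚ
ℕtoℚ k = (+ k) / 1

avgThr : ∀ {n} → .{{ℕ.NonZero n}} → (Fin n → ℕ) → ℚ
avgThr {n} τ = (+ sumF τ) / n

maxThr : ∀ {n} → (Fin n → ℕ) → ℕ
maxThr τ = maxF τ

density : ∀ {n} → .{{ℕ.NonZero n}} → Graph n → ℚ
density {n} G = (+ numEdges G) / n

-- Record for every vertex the stage at which the τ-dynamic process activates it. A vertex of M has
-- τ(v) ≤ t_M, and any other vertex has at least τ(v) neighbours activated at strictly earlier stages.
-- Charging each such edge to its later endpoint counts every edge at most once, hence
-- |G| t̄ = Σ τ ≤ |E(G)| + |M| t_M; dividing by t_M ≤ Δ gives both bounds.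

module Submission where

open import Data.Nat as ℕ using (ℕ)
open import Data.Fin using (Fin)
open import Data.Bool using (Bool)
open import Defs using (Graph)

module FinSum where

  open import Data.Nat using (ℕ; zero; suc; _+_; _*_; _≤_; _<_; z≤n)
  open import Data.Nat.Properties
  open import Data.Fin using (Fin) renaming (zero to fz; suc to fs)
  open import Data.Bool using (Bool; true; false; T; if_then_else_)
  open import Data.Empty using (⊥-elim)
  open import Algebra.Properties.CommutativeSemigroup +-commutativeSemigroup
    using () renaming (interchange to +-interchange)
  open import Relation.Binary.PropositionalEquality
  open import Defs using (sumF; maxF; card)

  ⟦_⟧ : Bool → ℕ
  ⟦ b ⟧ = if b then 1 else 0

  ⟦⟧-mono : ∀ {b c} → (T b → T c) → ⟦ b ⟧ ≤ ⟦ c ⟧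
  ⟦⟧-mono {false}         _   = z≤n
  ⟦⟧-mono {true} {true}   _   = ≤-refl
  ⟦⟧-mono {true} {false} b⇒c = ⊥-elim (b⇒c _)

  sumF-cong : ∀ {n} {f g : Fin n → ℕ} → (∀ i → f i ≡ g i) → sumF f ≡ sumF g
  sumF-cong {zero}  f≡g = refl
  sumF-cong {suc n} f≡g = cong₂ _+_ (f≡g fz) (sumF-cong (λ i → f≡g (fs i)))

  sumF-mono : ∀ {n} {f g : Fin n → ℕ} → (∀ i → f i ≤ g i) → sumF f ≤ sumF g
  sumF-mono {zero}  f≤g = z≤n
  sumF-mono {suc n} f≤g = +-mono-≤ (f≤g fz) (sumF-mono (λ i → f≤g (fs i)))

  card-mono : ∀ {n} {S S′ : Fin n → Bool} → (∀ i → T (S i) → T (S′ i)) → card S ≤ card S′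
  card-mono S⊆S′ = sumF-mono (λ i → ⟦⟧-mono (S⊆S′ i))

  sumF-+ : ∀ {n} (f g : Fin n → ℕ) → sumF (λ i → f i + g i) ≡ sumF f + sumF g
  sumF-+ {zero}  f g = refl
  sumF-+ {suc n} f g = trans (cong ((f fz + g fz) +_) (sumF-+ (λ i → f (fs i)) (λ i → g (fs i))))
                             (+-interchange (f fz) (g fz) _ _)

  sumF-*ʳ : ∀ {n} (f : Fin n → ℕ) c → sumF (λ i → f i * c) ≡ sumF f * c
  sumF-*ʳ {zero}  f c = refl
  sumF-*ʳ {suc n} f c = trans (cong (f fz * c +_) (sumF-*ʳ (λ i → f (fs i)) c))
                              (sym (*-distribʳ-+ c (f fz) _))

  sumF-const : ∀ {n} c → sumF {n} (λ _ → c) ≡ n * c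
  sumF-const {zero}  c = refl
  sumF-const {suc n} c = cong (c +_) (sumF-const {n} c)

  sumF-swap : ∀ {m n} (f : Fin m → Fin n → ℕ) →
              sumF (λ i → sumF (f i)) ≡ sumF (λ j → sumF (λ i → f i j))
  sumF-swap {zero}  {n} f = sym (trans (sumF-const {n} 0) (*-zeroʳ n))
  sumF-swap {suc m} f = trans (cong (sumF (f fz) +_) (sumF-swap (λ i → f (fs i))))
                              (sym (sumF-+ (f fz) (λ j → sumF (λ i → f (fs i) j))))

  sumF-symmetrise : ∀ {n} (f : Fin n → Fin n → ℕ) →
    sumF (λ i → sumF (f i)) + sumF (λ i → sumF (f i)) ≡ sumF (λ i → sumF (λ j → f i j + f j i))
  sumF-symmetrise f = begin
    sumF (λ i → sumF (f i)) + sumF (λ i → sumF (f i))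
      ≡⟨ cong (sumF (λ i → sumF (f i)) +_) (sumF-swap f) ⟩
    sumF (λ i → sumF (f i)) + sumF (λ i → sumF (λ j → f j i))
      ≡⟨ sym (sumF-+ (λ i → sumF (f i)) (λ i → sumF (λ j → f j i))) ⟩
    sumF (λ i → sumF (f i) + sumF (λ j → f j i))
      ≡⟨ sumF-cong (λ i → sym (sumF-+ (f i) (λ j → f j i))) ⟩
    sumF (λ i → sumF (λ j → f i j + f j i)) ∎
    where open ≡-Reasoning

  maxF-upper : ∀ {n} (f : Fin n → ℕ) i → f i ≤ maxF f
  maxF-upper f fz     = m≤m⊔n _ _
  maxF-upper f (fs i) = ≤-trans (maxF-upper (λ j → f (fs j)) i) (m≤n⊔m _ _)

  maxF-mono : ∀ {n} {f g : Fin n → ℕ} → (∀ i → f i ≤ g i) → maxF f ≤ maxF g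
  maxF-mono {zero}  f≤g = z≤n
  maxF-mono {suc n} f≤g = ⊔-mono-≤ (f≤g fz) (maxF-mono (λ i → f≤g (fs i)))

  sumF≤n*maxF : ∀ {n} (f : Fin n → ℕ) → sumF f ≤ n * maxF f
  sumF≤n*maxF {n} f = ≤-trans (sumF-mono (maxF-upper f)) (≤-reflexive (sumF-const {n} (maxF f)))

  maxF-positive : ∀ {n} (f : Fin n → ℕ) → 0 < sumF f → 0 < maxF f
  maxF-positive {n} f 0<Σf = n≢0⇒n>0 λ maxf≡0 → <-irrefl refl (<-≤-trans 0<Σf (begin
    sumF f        ≤⟨ sumF≤n*maxF f ⟩
    n * maxF f    ≡⟨ cong (n *_) maxf≡0 ⟩
    n * 0         ≡⟨ *-zeroʳ n ⟩
    0             ∎))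
    where open ≤-Reasoning

module EdgeCount where

  open import Data.Nat using (ℕ; _+_; _≤_; _<ᵇ_; z≤n)
  open import Data.Nat.Properties
  open import Data.Fin using (Fin; toℕ)
  open import Data.Fin.Properties using (toℕ-injective)
  open import Data.Bool using (true; false; T; _∧_; _∨_)
  open import Data.Bool.Properties using (T-∨)
  open import Data.Empty using (⊥; ⊥-elim)
  open import Data.Sum using (inj₁; inj₂)
  open import Function using (Equivalence)
  open import Relation.Binary using (tri<; tri≈; tri>)
  open import Relation.Binary.PropositionalEquality hiding ([_])
  open import Defs hiding (sym)
  open FinSum

  descendingEdges : ∀ {n} → Graph n → (Fin n → ℕ) → ℕ
  descendingEdges G r = sumF (λ v → card (λ u → adj G v u ∧ (r u <ᵇ r v)))

  ⟦∧⟧+⟦∧⟧≤⟦⟧ : ∀ x p q → (T p → T q → ⊥) → ⟦ x ∧ p ⟧ + ⟦ x ∧ q ⟧ ≤ ⟦ x ⟧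
  ⟦∧⟧+⟦∧⟧≤⟦⟧ false p     q     _      = ≤-refl
  ⟦∧⟧+⟦∧⟧≤⟦⟧ true  false false _      = z≤n
  ⟦∧⟧+⟦∧⟧≤⟦⟧ true  false true  _      = ≤-refl
  ⟦∧⟧+⟦∧⟧≤⟦⟧ true  true  false _      = ≤-refl
  ⟦∧⟧+⟦∧⟧≤⟦⟧ true  true  true  p∧q⇒⊥ = ⊥-elim (p∧q⇒⊥ _ _)

  ⟦∧⟧+⟦∧⟧≡⟦⟧ : ∀ x p q → (T p → T q → ⊥) → (T x → T (p ∨ q)) → ⟦ x ∧ p ⟧ + ⟦ x ∧ q ⟧ ≡ ⟦ x ⟧
  ⟦∧⟧+⟦∧⟧≡⟦⟧ false p     q     _      _     = refl
  ⟦∧⟧+⟦∧⟧≡⟦⟧ true  false false _      x⇒p∨q = ⊥-elim (x⇒p∨q _)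
  ⟦∧⟧+⟦∧⟧≡⟦⟧ true  false true  _      _     = refl
  ⟦∧⟧+⟦∧⟧≡⟦⟧ true  true  false _      _     = refl
  ⟦∧⟧+⟦∧⟧≡⟦⟧ true  true  true  p∧q⇒⊥ _     = ⊥-elim (p∧q⇒⊥ _ _)

  <ᵇ-asym : ∀ a b → T (a <ᵇ b) → T (b <ᵇ a) → ⊥
  <ᵇ-asym a b a<b b<a = <-asym (<ᵇ⇒< a b a<b) (<ᵇ⇒< b a b<a)

  adj⇒toℕ-distinct : ∀ {n} (G : Graph n) v u → T (adj G v u) → T ((toℕ v <ᵇ toℕ u) ∨ (toℕ u <ᵇ toℕ v))
  adj⇒toℕ-distinct G v u vu with <-cmp (toℕ v) (toℕ u)
  ... | tri< v<u _ _ = Equivalence.from T-∨ (inj₁ (<⇒<ᵇ v<u))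
  ... | tri> _ _ u<v = Equivalence.from T-∨ (inj₂ (<⇒<ᵇ u<v))
  ... | tri≈ _ v≡u _ with refl ← toℕ-injective v≡u = ⊥-elim (subst T (irrefl G v) vu)

  handshake : ∀ {n} (G : Graph n) → sumF (deg G) ≡ numEdges G + numEdges G
  handshake {n} G = begin
    sumF (λ v → sumF (λ u → ⟦ adj G v u ⟧))  ≡⟨ sumF-cong (λ v → sumF-cong (λ u → sym (split v u))) ⟩
    sumF (λ v → sumF (λ u → g v u + g u v))  ≡⟨ sym (sumF-symmetrise g) ⟩
    numEdges G + numEdges G                   ∎
    where
      open ≡-Reasoning
      g : Fin n → Fin n → ℕ
      g u v = ⟦ adj G u v ∧ (toℕ u <ᵇ toℕ v) ⟧
      split : ∀ v u → g v u + g u v ≡ ⟦ adj G v u ⟧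
      split v u rewrite Graph.sym G u v =
        ⟦∧⟧+⟦∧⟧≡⟦⟧ (adj G v u) _ _ (<ᵇ-asym (toℕ v) (toℕ u)) (adj⇒toℕ-distinct G v u)

  -- An edge descends in at most one direction but contributes to two degrees.
  descendingEdges-twice≤ : ∀ {n} (G : Graph n) r → descendingEdges G r + descendingEdges G r ≤ sumF (deg G)
  descendingEdges-twice≤ {n} G r = begin
    descendingEdges G r + descendingEdges G r  ≡⟨ sumF-symmetrise h ⟩
    sumF (λ v → sumF (λ u → h v u + h u v))    ≤⟨ sumF-mono (λ v → sumF-mono (λ u → pair v u)) ⟩
    sumF (deg G)                               ∎
    where
      open ≤-Reasoning
      h : Fin n → Fin n → ℕ
      h v u = ⟦ adj G v u ∧ (r u <ᵇ r v) ⟧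
      pair : ∀ v u → h v u + h u v ≤ ⟦ adj G v u ⟧
      pair v u rewrite Graph.sym G u v = ⟦∧⟧+⟦∧⟧≤⟦⟧ (adj G v u) _ _ (<ᵇ-asym (r u) (r v))

  m+m≤n+n⇒m≤n : ∀ {m n} → m + m ≤ n + n → m ≤ n
  m+m≤n+n⇒m≤n m+m≤n+n = ≮⇒≥ (λ n<m → <⇒≱ (+-mono-< n<m n<m) m+m≤n+n)

  descendingEdges≤numEdges : ∀ {n} (G : Graph n) r → descendingEdges G r ≤ numEdges G
  descendingEdges≤numEdges G r =
    m+m≤n+n⇒m≤n (≤-trans (descendingEdges-twice≤ G r) (≤-reflexive (handshake G)))

module DynamicProcess {n} (G : Graph n) (τ : Fin n → ℕ) (M : Fin n → Bool) where

  open import Data.Nat using (ℕ; zero; suc; _+_; _*_; _≤_; _<_; _<ᵇ_; z≤n; s≤s)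
  open import Data.Nat.Properties
  open import Data.Fin using (Fin)
  open import Data.Bool using (Bool; true; false; T; _∧_)
  open import Data.Bool.Properties using (T-≡; T-∧; T-∨; T-not-≡)
  open import Data.Product using (∃-syntax; _×_; _,_; proj₁; proj₂)
  open import Data.Sum using (inj₁; inj₂)
  open import Data.Empty using (⊥-elim)
  open import Function using (Equivalence)
  open import Relation.Binary using (tri<; tri≈; tri>)
  open import Relation.Binary.PropositionalEquality hiding ([_])
  open import Relation.Nullary using (¬_)
  open import Defs hiding (sym)
  open Equivalence using (to; from)
  open FinSum
  open EdgeCount using (descendingEdges; descendingEdges≤numEdges)

  private
    Dᵢ : ℕ → Fin n → Bool
    Dᵢ = D G τ M
    Accᵢ : ℕ → Fin n → Bool
    Accᵢ = Acc G τ M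

  D⇒Acc : ∀ i {v} → T (Dᵢ i v) → T (Accᵢ i v)
  D⇒Acc zero    d = d
  D⇒Acc (suc i) d = from T-∨ (inj₂ d)

  Acc-mono : ∀ {i j v} → i ≤ j → T (Accᵢ i v) → T (Accᵢ j v)
  Acc-mono {j = zero}  z≤n   a = a
  Acc-mono {j = suc j} i≤1+j a with m≤n⇒m<n∨m≡n i≤1+j
  ... | inj₁ i<1+j = from T-∨ (inj₁ (Acc-mono (≤-pred i<1+j) a))
  ... | inj₂ refl  = a

  Acc⇒D : ∀ {i v} → T (Accᵢ i v) → ∃[ j ] j ≤ i × T (Dᵢ j v)
  Acc⇒D {zero}  a = 0 , z≤n , a
  Acc⇒D {suc i} a with to T-∨ a
  ... | inj₁ a′ = let j , j≤i , d = Acc⇒D a′ in j , m≤n⇒m≤1+n j≤i , d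
  ... | inj₂ d  = suc i , ≤-refl , d

  D-suc⇒¬Acc : ∀ {i v} → T (Dᵢ (suc i) v) → ¬ T (Accᵢ i v)
  D-suc⇒¬Acc d = subst T (to T-not-≡ (proj₁ (to T-∧ d)))

  D-suc⇒threshold : ∀ {i v} → T (Dᵢ (suc i) v) → τ v ≤ nbrsIn G (Accᵢ i) v
  D-suc⇒threshold d = ≤ᵇ⇒≤ _ _ (proj₂ (to T-∧ d))

  D-<-disjoint : ∀ {i j v} → i < j → T (Dᵢ i v) → ¬ T (Dᵢ j v)
  D-<-disjoint {i} {suc j} {v} (s≤s i≤j) dᵢ dⱼ =
    D-suc⇒¬Acc {j} {v} dⱼ (Acc-mono {i} {j} {v} i≤j (D⇒Acc i {v} dᵢ))

  D-unique : ∀ {i j v} → T (Dᵢ i v) → T (Dᵢ j v) → i ≡ j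
  D-unique {i} {j} dᵢ dⱼ with <-cmp i j
  ... | tri< i<j _ _ = ⊥-elim (D-<-disjoint i<j dᵢ dⱼ)
  ... | tri≈ _ i≡j _ = i≡j
  ... | tri> _ _ j<i = ⊥-elim (D-<-disjoint j<i dⱼ dᵢ)

  module _ (dynamo : IsDynamo G τ M) where

    stage : Fin n → ℕ
    stage v = proj₁ (dynamo v)

    D-stage : ∀ v → T (Dᵢ (stage v) v)
    D-stage v = from T-≡ (proj₂ (dynamo v))

    Acc⇒stage≤ : ∀ {i u} → T (Accᵢ i u) → stage u ≤ i
    Acc⇒stage≤ {i} {u} a with Acc⇒D {i} {u} a
    ... | j , j≤i , d = subst (_≤ i) (D-unique {v = u} d (D-stage u)) j≤i

    threshold≤seed+earlier : ∀ i {v} → T (Dᵢ i v) →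
      τ v ≤ ⟦ M v ⟧ * maxF τ + card (λ u → adj G v u ∧ (stage u <ᵇ i))
    threshold≤seed+earlier zero {v} d with M v
    ... | true  = ≤-trans (maxF-upper τ v) (≤-trans (m≤m+n _ 0) (m≤m+n _ _))
    ... | false = ⊥-elim d
    threshold≤seed+earlier (suc i) {v} d = begin
      τ v                                               ≤⟨ D-suc⇒threshold {i} {v} d ⟩
      nbrsIn G (Accᵢ i) v                               ≤⟨ card-mono activated-earlier ⟩
      card (λ u → adj G v u ∧ (stage u <ᵇ suc i))       ≤⟨ m≤n+m _ _ ⟩
      ⟦ M v ⟧ * maxF τ + card (λ u → adj G v u ∧ (stage u <ᵇ suc i)) ∎
      where
        open ≤-Reasoning
        activated-earlier : ∀ u → T (adj G v u ∧ Accᵢ i u) → T (adj G v u ∧ (stage u <ᵇ suc i))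
        activated-earlier u vu∧a with vu , a ← to T-∧ vu∧a =
          from T-∧ (vu , <⇒<ᵇ (s≤s (Acc⇒stage≤ {i} {u} a)))

    sum-threshold≤seeds+descendingEdges : sumF τ ≤ card M * maxF τ + descendingEdges G stage
    sum-threshold≤seeds+descendingEdges = begin
      sumF τ
        ≤⟨ sumF-mono (λ v → threshold≤seed+earlier (stage v) (D-stage v)) ⟩
      sumF (λ v → ⟦ M v ⟧ * maxF τ + card (λ u → adj G v u ∧ (stage u <ᵇ stage v)))
        ≡⟨ sumF-+ (λ v → ⟦ M v ⟧ * maxF τ) _ ⟩
      sumF (λ v → ⟦ M v ⟧ * maxF τ) + descendingEdges G stage
        ≡⟨ cong (_+ descendingEdges G stage) (sumF-*ʳ (λ v → ⟦ M v ⟧) (maxF τ)) ⟩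
      card M * maxF τ + descendingEdges G stage ∎
      where open ≤-Reasoning

  dynamo⇒sum-threshold≤ : IsDynamo G τ M → sumF τ ≤ numEdges G + card M * maxF τ
  dynamo⇒sum-threshold≤ dynamo = begin
    sumF τ                                             ≤⟨ sum-threshold≤seeds+descendingEdges dynamo ⟩
    card M * maxF τ + descendingEdges G (stage dynamo) ≤⟨ +-monoʳ-≤ _ (descendingEdges≤numEdges G (stage dynamo)) ⟩
    card M * maxF τ + numEdges G                       ≡⟨ +-comm _ (numEdges G) ⟩
    numEdges G + card M * maxF τ                       ∎
    where open ≤-Reasoning

module RationalBound where

  open import Data.Nat as ℕ using (zero; suc; z<s)
  open import Data.Nat.Coprimality using (1-coprimeTo)
  import Data.Nat.Coprimality as Coprimality
  open import Data.Integer as ℤ using (+_)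
  import Data.Integer.Properties as ℤ
  import Data.Nat.Properties as ℕₚ
  open import Data.Rational
  open import Data.Rational.Properties
  open import Data.Rational.Solver using (module +-*-Solver)
  import Data.Rational.Unnormalised as ℚᵘ
  import Data.Rational.Unnormalised.Properties as ℚᵘ
  open import Relation.Binary.PropositionalEquality
  open import Relation.Nullary using (yes; no; contradiction)
  open import Defs using (ℕtoℚ; _÷₀_)

  ℕtoℚ≡mkℚ : ∀ k → ℕtoℚ k ≡ mkℚ (+ k) 0 (Coprimality.sym (1-coprimeTo k))
  ℕtoℚ≡mkℚ k = normalize-coprime (Coprimality.sym (1-coprimeTo k))

  toℚᵘ-ℕtoℚ : ∀ k → toℚᵘ (ℕtoℚ k) ≡ ℚᵘ.mkℚᵘ (+ k) 0
  toℚᵘ-ℕtoℚ k rewrite ℕtoℚ≡mkℚ k = refl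

  ℕtoℚ-+ : ∀ a b → ℕtoℚ (a ℕ.+ b) ≡ ℕtoℚ a + ℕtoℚ b
  ℕtoℚ-+ a b = toℚᵘ-injective (begin
    toℚᵘ (ℕtoℚ (a ℕ.+ b))                     ≡⟨ toℚᵘ-ℕtoℚ (a ℕ.+ b) ⟩
    ℚᵘ.mkℚᵘ (+ (a ℕ.+ b)) 0                   ≈⟨ ℚᵘ.*≡* (cong (ℤ._* + 1) a+b≡a*1+b*1) ⟩
    ℚᵘ.mkℚᵘ (+ a) 0 ℚᵘ.+ ℚᵘ.mkℚᵘ (+ b) 0      ≡⟨ sym (cong₂ ℚᵘ._+_ (toℚᵘ-ℕtoℚ a) (toℚᵘ-ℕtoℚ b)) ⟩
    toℚᵘ (ℕtoℚ a) ℚᵘ.+ toℚᵘ (ℕtoℚ b)          ≈⟨ ℚᵘ.≃-sym (toℚᵘ-homo-+ (ℕtoℚ a) (ℕtoℚ b)) ⟩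
    toℚᵘ (ℕtoℚ a + ℕtoℚ b)                    ∎)
    where
      open ℚᵘ.≃-Reasoning
      a+b≡a*1+b*1 : + (a ℕ.+ b) ≡ + a ℤ.* + 1 ℤ.+ + b ℤ.* + 1
      a+b≡a*1+b*1 = trans (ℤ.pos-+ a b) (sym (cong₂ ℤ._+_ (ℤ.*-identityʳ (+ a)) (ℤ.*-identityʳ (+ b))))

  ℕtoℚ-* : ∀ a b → ℕtoℚ (a ℕ.* b) ≡ ℕtoℚ a * ℕtoℚ b
  ℕtoℚ-* a b = toℚᵘ-injective (begin
    toℚᵘ (ℕtoℚ (a ℕ.* b))                     ≡⟨ toℚᵘ-ℕtoℚ (a ℕ.* b) ⟩
    ℚᵘ.mkℚᵘ (+ (a ℕ.* b)) 0                   ≈⟨ ℚᵘ.*≡* (cong (ℤ._* + 1) (ℤ.pos-* a b)) ⟩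
    ℚᵘ.mkℚᵘ (+ a) 0 ℚᵘ.* ℚᵘ.mkℚᵘ (+ b) 0      ≡⟨ sym (cong₂ ℚᵘ._*_ (toℚᵘ-ℕtoℚ a) (toℚᵘ-ℕtoℚ b)) ⟩
    toℚᵘ (ℕtoℚ a) ℚᵘ.* toℚᵘ (ℕtoℚ b)          ≈⟨ ℚᵘ.≃-sym (toℚᵘ-homo-* (ℕtoℚ a) (ℕtoℚ b)) ⟩
    toℚᵘ (ℕtoℚ a * ℕtoℚ b)                    ∎)
    where open ℚᵘ.≃-Reasoning

  ℕtoℚ-mono : ∀ {a b} → a ℕ.≤ b → ℕtoℚ a ≤ ℕtoℚ b
  ℕtoℚ-mono {a} {b} a≤b rewrite ℕtoℚ≡mkℚ a | ℕtoℚ≡mkℚ b =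
    *≤* (subst₂ ℤ._≤_ (sym (ℤ.*-identityʳ (+ a))) (sym (ℤ.*-identityʳ (+ b))) (ℤ.+≤+ a≤b))

  ℕtoℚ*[k/N]≡k : ∀ N k .{{_ : ℕ.NonZero N}} → ℕtoℚ N * ((+ k) / N) ≡ ℕtoℚ k
  ℕtoℚ*[k/N]≡k N@(suc N-1) k = toℚᵘ-injective (begin
    toℚᵘ (ℕtoℚ N * ((+ k) / N))                 ≈⟨ toℚᵘ-homo-* (ℕtoℚ N) ((+ k) / N) ⟩
    toℚᵘ (ℕtoℚ N) ℚᵘ.* toℚᵘ ((+ k) / N)         ≈⟨ ℚᵘ.*-cong (ℚᵘ.≃-reflexive (toℚᵘ-ℕtoℚ N))
                                                               (toℚᵘ-fromℚᵘ (ℚᵘ.mkℚᵘ (+ k) N-1)) ⟩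
    ℚᵘ.mkℚᵘ (+ N) 0 ℚᵘ.* ℚᵘ.mkℚᵘ (+ k) N-1       ≈⟨ ℚᵘ.*≡* N*k≡k*N ⟩
    ℚᵘ.mkℚᵘ (+ k) 0                             ≡⟨ sym (toℚᵘ-ℕtoℚ k) ⟩
    toℚᵘ (ℕtoℚ k)                               ∎)
    where
      open ℚᵘ.≃-Reasoning
      N*k≡k*N : (+ N ℤ.* + k) ℤ.* + 1 ≡ + k ℤ.* + suc (N-1 ℕ.+ 0)
      N*k≡k*N = trans (ℤ.*-identityʳ _) (trans (ℤ.*-comm (+ N) (+ k))
                  (cong (λ d → + k ℤ.* + suc d) (sym (ℕₚ.+-identityʳ N-1))))

  ÷₀-pos : ∀ p {q} (0<q : 0ℚ < q) → p ÷₀ q ≡ p * (1/ q) {{>-nonZero 0<q}}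
  ÷₀-pos p {q} 0<q with q ≟ 0ℚ
  ... | yes refl = contradiction 0<q (<-irrefl refl)
  ... | no  _    = refl

  p≤q+r⇒p-q≤r : ∀ {p q r} → p ≤ q + r → p - q ≤ r
  p≤q+r⇒p-q≤r {p} {q} {r} p≤q+r = subst (p - q ≤_) (q+r-q≡r q r) (+-monoˡ-≤ (- q) p≤q+r)
    where
      open +-*-Solver
      q+r-q≡r : ∀ q r → (q + r) - q ≡ r
      q+r-q≡r = solve 2 (λ q r → (q :+ r) :- q := r) refl

  0<k/N⇒0<k : ∀ {k} N .{{_ : ℕ.NonZero N}} → 0ℚ < (+ k) / N → 0 ℕ.< k
  0<k/N⇒0<k {zero}  N 0<0/N = contradiction (subst (0ℚ <_) (0/n≡0 N) 0<0/N) (<-irrefl refl)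
  0<k/N⇒0<k {suc k} N _     = z<s

  N[1-ε/t][t/s]≤m : ∀ N .{{_ : ℕ.NonZero N}} T E m s → 0ℚ < (+ T) / N → 0 ℕ.< s → T ℕ.≤ E ℕ.+ m ℕ.* s →
    ℕtoℚ N * (1ℚ - ((+ E) / N) ÷₀ ((+ T) / N)) * (((+ T) / N) ÷₀ ℕtoℚ s) ≤ ℕtoℚ m
  N[1-ε/t][t/s]≤m N T E m s@(suc s-1) 0<t _ T≤E+ms = *-cancelʳ-≤-pos S {{S>0}} (begin
    ℕtoℚ N * (1ℚ - ε ÷₀ t) * (t ÷₀ S) * S
      ≡⟨ cong₂ (λ a b → ℕtoℚ N * (1ℚ - a) * b * S) (÷₀-pos ε 0<t) (÷₀-pos t 0<S) ⟩
    ℕtoℚ N * (1ℚ - ε * 1/ t) * (t * 1/ S) * S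
      ≡⟨ regroup (ℕtoℚ N) ε t (1/ t) S (1/ S) ⟩
    (ℕtoℚ N * t - ℕtoℚ N * ε * (t * 1/ t)) * (1/ S * S)
      ≡⟨ cong₂ (λ a b → (ℕtoℚ N * t - ℕtoℚ N * ε * a) * b) (*-inverseʳ t) (*-inverseˡ S) ⟩
    (ℕtoℚ N * t - ℕtoℚ N * ε * 1ℚ) * 1ℚ
      ≡⟨ drop-units (ℕtoℚ N * t) (ℕtoℚ N * ε) ⟩
    ℕtoℚ N * t - ℕtoℚ N * ε
      ≡⟨ cong₂ _-_ (ℕtoℚ*[k/N]≡k N T) (ℕtoℚ*[k/N]≡k N E) ⟩
    ℕtoℚ T - ℕtoℚ E
      ≤⟨ p≤q+r⇒p-q≤r T≤E+mS ⟩
    ℕtoℚ m * S ∎)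
    where
      open ≤-Reasoning
      open +-*-Solver using (solve; _:+_; _:-_; _:*_; _:=_; con)
      t ε S : ℚ
      t = (+ T) / N
      ε = (+ E) / N
      S = ℕtoℚ s
      S>0 : Positive S
      S>0 = normalize-pos s 1
      0<S : 0ℚ < S
      0<S = positive⁻¹ S {{S>0}}
      instance
        t≢0 : NonZero t
        t≢0 = >-nonZero 0<t
        S≢0 : NonZero S
        S≢0 = >-nonZero 0<S
      T≤E+mS : ℕtoℚ T ≤ ℕtoℚ E + ℕtoℚ m * S
      T≤E+mS = subst (ℕtoℚ T ≤_) (trans (ℕtoℚ-+ E (m ℕ.* s)) (cong (λ r → ℕtoℚ E + r) (ℕtoℚ-* m s)))
                     (ℕtoℚ-mono T≤E+ms)
      regroup : ∀ n e x x⁻¹ y y⁻¹ →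
        n * (1ℚ - e * x⁻¹) * (x * y⁻¹) * y ≡ (n * x - n * e * (x * x⁻¹)) * (y⁻¹ * y)
      regroup = solve 6 (λ n e x x⁻¹ y y⁻¹ →
        n :* (con 1ℚ :- e :* x⁻¹) :* (x :* y⁻¹) :* y := (n :* x :- n :* e :* (x :* x⁻¹)) :* (y⁻¹ :* y)) refl
      drop-units : ∀ a b → (a - b * 1ℚ) * 1ℚ ≡ a - b
      drop-units = solve 2 (λ a b → (a :- b :* con 1ℚ) :* con 1ℚ := a :- b) refl

open import Defs
open import Data.Nat.Properties using (≤-trans; <-≤-trans; +-monoʳ-≤; *-monoʳ-≤)
open import Data.Product using (_×_; _,_)
open import Data.Rational using (ℚ; 0ℚ; 1ℚ; _*_; _-_; _≤_; _<_)
open FinSum using (maxF-mono; maxF-positive)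
open DynamicProcess using (dynamo⇒sum-threshold≤)
open RationalBound using (0<k/N⇒0<k; N[1-ε/t][t/s]≤m)

theorem1 : (n : ℕ) → .{{_ : ℕ.NonZero n}} → (G : Graph n) → (τ : Fin n → ℕ) →
    IsThreshold G τ → 0ℚ < avgThr τ → (M : Fin n → Bool) → IsDynamo G τ M →
      (ℕtoℚ n * (1ℚ - density G ÷₀ avgThr τ) * (avgThr τ ÷₀ ℕtoℚ (maxThr τ)) ≤ ℕtoℚ (card M))
      × (ℕtoℚ n * (1ℚ - density G ÷₀ avgThr τ) * (avgThr τ ÷₀ ℕtoℚ (maxDeg G)) ≤ ℕtoℚ (card M))
theorem1 n G τ isThreshold 0<t̄ M dynamo =
  N[1-ε/t][t/s]≤m n (sumF τ) (numEdges G) (card M) (maxF τ) 0<t̄ 0<tₘ count ,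
  N[1-ε/t][t/s]≤m n (sumF τ) (numEdges G) (card M) (maxDeg G) 0<t̄ (<-≤-trans 0<tₘ tₘ≤Δ)
    (≤-trans count (+-monoʳ-≤ (numEdges G) (*-monoʳ-≤ (card M) tₘ≤Δ)))
  where
    count : sumF τ ℕ.≤ numEdges G ℕ.+ card M ℕ.* maxF τ
    count = dynamo⇒sum-threshold≤ G τ M dynamo
    0<tₘ : 0 ℕ.< maxF τ
    0<tₘ = maxF-positive τ (0<k/N⇒0<k n 0<t̄)
    tₘ≤Δ : maxF τ ℕ.≤ maxDeg G
    tₘ≤Δ = maxF-mono isThreshold
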